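{- Let $\mathbb{C}$ be a small strict monoidal category, and let $\mathbb{C}\langle\mathsf{x}_O\rangle$ be the coproduct in $\mathsf{StrMonCat}$ of $\mathbb{C}$ with the free strict monoidal category on one object. Then there is an isomorphism of monoids $\mathrm{Arr}(\mathbb{C}\langle\mathsf{x}_O\rangle)\cong\mathrm{Arr}(\mathbb{C})\langle\mathsf{x}\rangle$.
   Context: $\mathsf{StrMonCat}$ is the category of small strict monoidal categories and strict monoidal functors. For a strict monoidal category $\mathbb{D}$, $\mathrm{Arr}(\mathbb{D})$ is the monoid of arrows of $\mathbb{D}$ under the tensor product $\otimes$ with unit $\mathrm{id}(I)$. For a monoid $M$, $M\langle\mathsf{x}\rangle$ denotes the coproduct in the category of monoids of $M$ with the free monoid on one generator $\mathsf{x}$ (i.e. $M$ with an indeterminate adjoined). -}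

module Defs where

open import Data.Nat using (ℕ; zero; suc; _+_)
open import Data.Nat.Properties using (+-assoc; +-identityʳ; ≡-irrelevant)
open import Data.Product using (Σ; _×_; _,_; proj₁; proj₂)
open import Relation.Binary.PropositionalEquality
  using (_≡_; refl; sym; trans; cong; cong₂)

-- Strictness of ⊗ on arrows is stated as equality in the type of all
-- arrows  Σ A B. Hom A B  (this avoids transport along object equations).

record SMC : Set₁ where
  infixr 9 _∘_
  infixr 10 _⊗₀_ _⊗₁_
  field
    Ob  : Set
    Hom : Ob → Ob → Set
    id  : ∀ {A} → Hom A A
    _∘_ : ∀ {A B C} → Hom B C → Hom A B → Hom A C
    identityˡ : ∀ {A B} (f : Hom A B) → id ∘ f ≡ f
    identityʳ : ∀ {A B} (f : Hom A B) → f ∘ id ≡ f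
    assoc : ∀ {A B C D} (h : Hom C D) (g : Hom B C) (f : Hom A B) →
            (h ∘ g) ∘ f ≡ h ∘ (g ∘ f)
    I    : Ob
    _⊗₀_ : Ob → Ob → Ob
    _⊗₁_ : ∀ {A B C D} → Hom A B → Hom C D → Hom (A ⊗₀ C) (B ⊗₀ D)
    ⊗-id : ∀ {A B} → id {A} ⊗₁ id {B} ≡ id
    ⊗-∘  : ∀ {A B C A' B' C'} (g : Hom B C) (f : Hom A B)
             (g' : Hom B' C') (f' : Hom A' B') →
           (g ∘ f) ⊗₁ (g' ∘ f') ≡ (g ⊗₁ g') ∘ (f ⊗₁ f')
    ⊗₀-assoc : ∀ A B C → (A ⊗₀ B) ⊗₀ C ≡ A ⊗₀ (B ⊗₀ C)
    ⊗₀-unitˡ : ∀ A → I ⊗₀ A ≡ A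
    ⊗₀-unitʳ : ∀ A → A ⊗₀ I ≡ A
    ⊗₁-assoc : ∀ {A B C D E F} (f : Hom A B) (g : Hom C D) (h : Hom E F) →
               _≡_ {A = Σ Ob λ X → Σ Ob λ Y → Hom X Y}
                   (_ , _ , (f ⊗₁ g) ⊗₁ h) (_ , _ , f ⊗₁ (g ⊗₁ h))
    ⊗₁-unitˡ : ∀ {A B} (f : Hom A B) →
               _≡_ {A = Σ Ob λ X → Σ Ob λ Y → Hom X Y}
                   (_ , _ , id {I} ⊗₁ f) (_ , _ , f)
    ⊗₁-unitʳ : ∀ {A B} (f : Hom A B) →
               _≡_ {A = Σ Ob λ X → Σ Ob λ Y → Hom X Y}
                   (_ , _ , f ⊗₁ id {I}) (_ , _ , f)

Arrows : SMC → Set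
Arrows C = Σ Ob λ A → Σ Ob λ B → Hom A B
  where open SMC C

record SMF (C D : SMC) : Set where
  private
    module C = SMC C
    module D = SMC D
  field
    F₀ : C.Ob → D.Ob
    F₁ : ∀ {A B} → C.Hom A B → D.Hom (F₀ A) (F₀ B)
    F-id : ∀ {A} → F₁ (C.id {A}) ≡ D.id
    F-∘  : ∀ {A B C'} (g : C.Hom B C') (f : C.Hom A B) →
           F₁ (g C.∘ f) ≡ F₁ g D.∘ F₁ f
    F-I  : F₀ C.I ≡ D.I
    F-⊗₀ : ∀ A B → F₀ (A C.⊗₀ B) ≡ F₀ A D.⊗₀ F₀ B
    F-⊗₁ : ∀ {A B A' B'} (f : C.Hom A B) (g : C.Hom A' B') →
           _≡_ {A = Arrows D} (_ , _ , F₁ (f C.⊗₁ g)) (_ , _ , F₁ f D.⊗₁ F₁ g)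

arrMap : ∀ {C D} → SMF C D → Arrows C → Arrows D
arrMap F (A , B , f) = F₀ A , F₀ B , F₁ f
  where open SMF F

_∘F_ : ∀ {C D E} → SMF D E → SMF C D → SMF C E
_∘F_ {C} {D} {E} G H = record
  { F₀ = λ A → G.F₀ (H.F₀ A)
  ; F₁ = λ f → G.F₁ (H.F₁ f)
  ; F-id = trans (cong G.F₁ H.F-id) G.F-id
  ; F-∘ = λ g f → trans (cong G.F₁ (H.F-∘ g f)) (G.F-∘ (H.F₁ g) (H.F₁ f))
  ; F-I = trans (cong G.F₀ H.F-I) G.F-I
  ; F-⊗₀ = λ A B → trans (cong G.F₀ (H.F-⊗₀ A B)) (G.F-⊗₀ (H.F₀ A) (H.F₀ B))
  ; F-⊗₁ = λ f g → trans (cong (arrMap G) (H.F-⊗₁ f g)) (G.F-⊗₁ (H.F₁ f) (H.F₁ g))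
  }
  where
    module G = SMF G
    module H = SMF H

_≈F_ : ∀ {C D} → SMF C D → SMF C D → Set
_≈F_ {C} {D} F G =
  (∀ A → SMF.F₀ F A ≡ SMF.F₀ G A) ×
  (∀ {A B} (f : SMC.Hom C A B) → arrMap F (A , B , f) ≡ arrMap G (A , B , f))

IsCoproductSMC : ∀ {C D E} → SMF C E → SMF D E → Set₁
IsCoproductSMC {C} {D} {E} i j =
  (X : SMC) (f : SMF C X) (g : SMF D X) →
  Σ (SMF E X) λ h →
    ((h ∘F i) ≈F f) × ((h ∘F j) ≈F g) ×
    ((h' : SMF E X) → (h' ∘F i) ≈F f → (h' ∘F j) ≈F g → h' ≈F h)

-- The free strict monoidal category on one object:
-- objects are natural numbers (x^n), only identity arrows.

private
  triple : ∀ {a a' b b' : ℕ} {p : a ≡ b} {p' : a' ≡ b'} → a ≡ a' → b ≡ b' →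
           _≡_ {A = Σ ℕ λ X → Σ ℕ λ Y → X ≡ Y} (a , b , p) (a' , b' , p')
  triple {p = p} {p'} refl refl = cong (λ q → _ , _ , q) (≡-irrelevant p p')

FreeSMC1 : SMC
FreeSMC1 = record
  { Ob = ℕ
  ; Hom = _≡_
  ; id = refl
  ; _∘_ = λ g f → trans f g
  ; identityˡ = λ _ → ≡-irrelevant _ _
  ; identityʳ = λ _ → ≡-irrelevant _ _
  ; assoc = λ _ _ _ → ≡-irrelevant _ _
  ; I = 0
  ; _⊗₀_ = _+_
  ; _⊗₁_ = cong₂ _+_
  ; ⊗-id = ≡-irrelevant _ _
  ; ⊗-∘ = λ _ _ _ _ → ≡-irrelevant _ _
  ; ⊗₀-assoc = +-assoc
  ; ⊗₀-unitˡ = λ _ → refl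
  ; ⊗₀-unitʳ = +-identityʳ
  ; ⊗₁-assoc = λ {A} {B} {C} {D} {E} {F} _ _ _ → triple (+-assoc A C E) (+-assoc B D F)
  ; ⊗₁-unitˡ = λ _ → triple refl refl
  ; ⊗₁-unitʳ = λ {A} {B} _ → triple (+-identityʳ A) (+-identityʳ B)
  }

record Mon : Set₁ where
  infixl 7 _∙_
  field
    Carrier : Set
    _∙_ : Carrier → Carrier → Carrier
    ε : Carrier
    assoc : ∀ x y z → (x ∙ y) ∙ z ≡ x ∙ (y ∙ z)
    identityˡ : ∀ x → ε ∙ x ≡ x
    identityʳ : ∀ x → x ∙ ε ≡ x

record MonHom (M N : Mon) : Set where
  private
    module M = Mon M
    module N = Mon N
  field
    fun : M.Carrier → N.Carrier
    pres-∙ : ∀ x y → fun (x M.∙ y) ≡ fun x N.∙ fun y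
    pres-ε : fun M.ε ≡ N.ε

_∘M_ : ∀ {L M N} → MonHom M N → MonHom L M → MonHom L N
_∘M_ {L} {M} {N} g f = record
  { fun = λ x → G.fun (F.fun x)
  ; pres-∙ = λ x y → trans (cong G.fun (F.pres-∙ x y)) (G.pres-∙ (F.fun x) (F.fun y))
  ; pres-ε = trans (cong G.fun F.pres-ε) G.pres-ε
  }
  where
    module G = MonHom g
    module F = MonHom f

_≈M_ : ∀ {M N} → MonHom M N → MonHom M N → Set
f ≈M g = ∀ x → MonHom.fun f x ≡ MonHom.fun g x

record MonIso (M N : Mon) : Set where
  field
    to   : MonHom M N
    from : MonHom N M
    from∘to : ∀ x → MonHom.fun from (MonHom.fun to x) ≡ x
    to∘from : ∀ y → MonHom.fun to (MonHom.fun from y) ≡ y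

IsCoproductMon : ∀ {M N P} → MonHom M P → MonHom N P → Set₁
IsCoproductMon {M} {N} {P} i j =
  (Q : Mon) (f : MonHom M Q) (g : MonHom N Q) →
  Σ (MonHom P Q) λ h →
    ((h ∘M i) ≈M f) × ((h ∘M j) ≈M g) ×
    ((h' : MonHom P Q) → (h' ∘M i) ≈M f → (h' ∘M j) ≈M g → h' ≈M h)

-- The free monoid on one generator x: (ℕ, +, 0), x = 1.
FreeMon1 : Mon
FreeMon1 = record
  { Carrier = ℕ ; _∙_ = _+_ ; ε = 0
  ; assoc = +-assoc ; identityˡ = λ _ → refl ; identityʳ = +-identityʳ }

Arr : SMC → Mon
Arr D = record
  { Carrier = Arrows D
  ; _∙_ = λ { (A , B , f) (A' , B' , g) → A ⊗₀ A' , B ⊗₀ B' , f ⊗₁ g }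
  ; ε = I , I , id
  ; assoc = λ { (_ , _ , f) (_ , _ , g) (_ , _ , h) → ⊗₁-assoc f g h }
  ; identityˡ = λ { (_ , _ , f) → ⊗₁-unitˡ f }
  ; identityʳ = λ { (_ , _ , f) → ⊗₁-unitʳ f }
  }
  where open SMC D

-- Arrows of C⟨xₒ⟩ are words f₀ x f₁ x ⋯ x fₙ of arrows of C, composed letterwise, and the
-- tensor of two words merges the last letter of the first with the first letter of the
-- second; so Arr(C⟨xₒ⟩) is the monoid of such words, which is exactly the normal form of
-- Arr(C)⟨x⟩. Since E is only given by its universal property, compare it with this word
-- category C⟨xₒ⟩: the comparison functors make Arr E, with Arr ι and n ↦ ιx(id xₒⁿ), a
-- coproduct of Arr C and ℕ in monoids, and coproducts are unique up to isomorphism.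
module Submission where

open import Defs
open import Data.Nat using (ℕ; zero; suc; _+_)
open import Data.Product using (Σ; _,_; proj₁; proj₂)
open import Relation.Binary.PropositionalEquality
open ≡-Reasoning

open MonHom using (fun; pres-∙; pres-ε)
open SMF using (F₀; F₁)

-- a₀ ∷ a₁ ∷ ⋯ ∷ [ aₙ ] stands for a₀ x a₁ x ⋯ x aₙ.
data Word (A : Set) : Set where
  [_] : A → Word A
  _∷_ : A → Word A → Word A

module WordMonoid (M : Mon) where
  open Mon M

  infixr 5 _◁_ _⊕_

  _◁_ : Carrier → Word Carrier → Word Carrier
  a ◁ [ b ] = [ a ∙ b ]
  a ◁ (b ∷ l) = (a ∙ b) ∷ l

  _⊕_ : Word Carrier → Word Carrier → Word Carrier
  [ a ] ⊕ m = a ◁ m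
  (a ∷ l) ⊕ m = a ∷ (l ⊕ m)

  ◁-◁ : ∀ a b m → a ◁ (b ◁ m) ≡ (a ∙ b) ◁ m
  ◁-◁ a b [ c ] = cong [_] (sym (assoc a b c))
  ◁-◁ a b (c ∷ m) = cong (_∷ m) (sym (assoc a b c))

  ◁-⊕ : ∀ a l m → a ◁ (l ⊕ m) ≡ (a ◁ l) ⊕ m
  ◁-⊕ a [ b ] m = ◁-◁ a b m
  ◁-⊕ a (b ∷ l) m = refl

  ⊕-assoc : ∀ l m n → (l ⊕ m) ⊕ n ≡ l ⊕ (m ⊕ n)
  ⊕-assoc [ a ] m n = sym (◁-⊕ a m n)
  ⊕-assoc (a ∷ l) m n = cong (a ∷_) (⊕-assoc l m n)

  ⊕-identityˡ : ∀ l → [ ε ] ⊕ l ≡ l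
  ⊕-identityˡ [ b ] = cong [_] (identityˡ b)
  ⊕-identityˡ (b ∷ l) = cong (_∷ l) (identityˡ b)

  ⊕-identityʳ : ∀ l → l ⊕ [ ε ] ≡ l
  ⊕-identityʳ [ a ] = cong [_] (identityʳ a)
  ⊕-identityʳ (a ∷ l) = cong (a ∷_) (⊕-identityʳ l)

_⟨x⟩ : Mon → Mon
M ⟨x⟩ = record
  { Carrier = Word (Mon.Carrier M) ; _∙_ = _⊕_ ; ε = [ Mon.ε M ]
  ; assoc = ⊕-assoc ; identityˡ = ⊕-identityˡ ; identityʳ = ⊕-identityʳ }
  where open WordMonoid M

module Eval {M N : Mon} (φ : MonHom M N) (x : Mon.Carrier N) where
  open Mon N
  open WordMonoid M using (_◁_; _⊕_)

  eval : Word (Mon.Carrier M) → Carrier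
  eval [ a ] = fun φ a
  eval (a ∷ l) = fun φ a ∙ (x ∙ eval l)

  eval-◁ : ∀ a l → eval (a ◁ l) ≡ fun φ a ∙ eval l
  eval-◁ a [ b ] = pres-∙ φ a b
  eval-◁ a (b ∷ l) = trans (cong (_∙ (x ∙ eval l)) (pres-∙ φ a b)) (assoc _ _ _)

  eval-⊕ : ∀ l m → eval (l ⊕ m) ≡ eval l ∙ eval m
  eval-⊕ [ a ] m = eval-◁ a m
  eval-⊕ (a ∷ l) m = begin
    fun φ a ∙ (x ∙ eval (l ⊕ m))    ≡⟨ cong (λ t → fun φ a ∙ (x ∙ t)) (eval-⊕ l m) ⟩
    fun φ a ∙ (x ∙ (eval l ∙ eval m)) ≡⟨ cong (fun φ a ∙_) (sym (assoc _ _ _)) ⟩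
    fun φ a ∙ ((x ∙ eval l) ∙ eval m) ≡⟨ sym (assoc _ _ _) ⟩
    (fun φ a ∙ (x ∙ eval l)) ∙ eval m ∎

  evalHom : MonHom (M ⟨x⟩) N
  evalHom = record { fun = eval ; pres-∙ = eval-⊕ ; pres-ε = pres-ε φ }

open Eval using (eval; evalHom)

eval-unique : ∀ {M N N'} (φ : MonHom M N) (x : Mon.Carrier N) (ψ : MonHom N N')
              {φ' : MonHom M N'} {x' : Mon.Carrier N'} →
              (ψ ∘M φ) ≈M φ' → fun ψ x ≡ x' →
              ∀ l → fun ψ (eval φ x l) ≡ eval φ' x' l
eval-unique {N = N} {N'} φ x ψ {φ'} {x'} ψφ≈φ' ψx≡x' = go
  where
  module N = Mon N
  module N' = Mon N'
  go : ∀ l → fun ψ (eval φ x l) ≡ eval φ' x' l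
  go [ a ] = ψφ≈φ' a
  go (a ∷ l) = begin
    fun ψ (fun φ a N.∙ (x N.∙ eval φ x l))
      ≡⟨ pres-∙ ψ _ _ ⟩
    fun ψ (fun φ a) N'.∙ fun ψ (x N.∙ eval φ x l)
      ≡⟨ cong (fun ψ (fun φ a) N'.∙_) (pres-∙ ψ _ _) ⟩
    fun ψ (fun φ a) N'.∙ (fun ψ x N'.∙ fun ψ (eval φ x l))
      ≡⟨ cong₂ N'._∙_ (ψφ≈φ' a) (cong₂ N'._∙_ ψx≡x' (go l)) ⟩
    fun φ' a N'.∙ (x' N'.∙ eval φ' x' l) ∎

idM : ∀ {M} → MonHom M M
idM = record { fun = λ x → x ; pres-∙ = λ _ _ → refl ; pres-ε = refl }

module _ {M N P : Mon} {i : MonHom M P} {j : MonHom N P} (cop : IsCoproductMon i j) where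

  coproductMon-endo≈id : (h : MonHom P P) → (h ∘M i) ≈M i → (h ∘M j) ≈M j →
                         ∀ p → fun h p ≡ p
  coproductMon-endo≈id h hi≈i hj≈j p =
    trans (unique h hi≈i hj≈j p) (sym (unique idM (λ _ → refl) (λ _ → refl) p))
    where unique = proj₂ (proj₂ (proj₂ (cop P i j)))

coproductMon-unique : ∀ {M N P P'} {i : MonHom M P} {j : MonHom N P}
                      {i' : MonHom M P'} {j' : MonHom N P'} →
                      IsCoproductMon i j → IsCoproductMon i' j' → MonIso P P'
coproductMon-unique {P = P} {P'} {i} {j} {i'} {j'} cop cop' = record
  { to = to ; from = from
  ; from∘to = coproductMon-endo≈id {i = i} {j} cop (from ∘M to)
      (λ a → trans (cong (fun from) (to∘i a)) (from∘i' a))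
      (λ b → trans (cong (fun from) (to∘j b)) (from∘j' b))
  ; to∘from = coproductMon-endo≈id {i = i'} {j'} cop' (to ∘M from)
      (λ a → trans (cong (fun to) (from∘i' a)) (to∘i a))
      (λ b → trans (cong (fun to) (from∘j' b)) (to∘j b))
  }
  where
  to = proj₁ (cop P' i' j')
  to∘i = proj₁ (proj₂ (cop P' i' j'))
  to∘j = proj₁ (proj₂ (proj₂ (cop P' i' j')))
  from = proj₁ (cop' P i j)
  from∘i' = proj₁ (proj₂ (cop' P i j))
  from∘j' = proj₁ (proj₂ (proj₂ (cop' P i j)))

idF : ∀ {C} → SMF C C
idF = record { F₀ = λ A → A ; F₁ = λ f → f ; F-id = refl ; F-∘ = λ _ _ → refl
             ; F-I = refl ; F-⊗₀ = λ _ _ → refl ; F-⊗₁ = λ _ _ → refl }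

∘F-resp-≈F : ∀ {B C D} (G : SMF C D) (F F' : SMF B C) (K : SMF B D) →
             F ≈F F' → (G ∘F F') ≈F K → (G ∘F F) ≈F K
∘F-resp-≈F G F F' K (p₀ , p₁) (q₀ , q₁) =
  (λ A → trans (cong (F₀ G) (p₀ A)) (q₀ A)) , λ f → trans (cong (arrMap G) (p₁ f)) (q₁ f)

module _ {C D E : SMC} {i : SMF C E} {j : SMF D E} (cop : IsCoproductSMC i j) where

  coproductSMC-endo≈id : (h : SMF E E) → (h ∘F i) ≈F i → (h ∘F j) ≈F j →
                         ∀ t → arrMap h t ≡ t
  coproductSMC-endo≈id h hi≈i hj≈j (A , B , f) =
    trans (proj₂ (unique h hi≈i hj≈j) f)
          (sym (proj₂ (unique idF ((λ _ → refl) , λ _ → refl) ((λ _ → refl) , λ _ → refl)) f))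
    where unique = proj₂ (proj₂ (proj₂ (cop E i j)))

idArrow-cong : (D : SMC) {A B : SMC.Ob D} → A ≡ B →
               _≡_ {A = Arrows D} (A , A , SMC.id D) (B , B , SMC.id D)
idArrow-cong D refl = refl

arrHom : ∀ {C D} → SMF C D → MonHom (Arr C) (Arr D)
arrHom {C} {D} F = record
  { fun = arrMap F
  ; pres-∙ = λ { (_ , _ , f) (_ , _ , g) → F-⊗₁ f g }
  ; pres-ε = trans (cong (λ g → _ , _ , g) F-id) (idArrow-cong D F-I) }
  where open SMF F

identities : MonHom FreeMon1 (Arr FreeSMC1)
identities = record { fun = λ n → n , n , refl ; pres-∙ = λ _ _ → refl ; pres-ε = refl }

Ob⊗ : SMC → Mon
Ob⊗ C = record { Carrier = Ob ; _∙_ = _⊗₀_ ; ε = I ; assoc = ⊗₀-assoc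
               ; identityˡ = ⊗₀-unitˡ ; identityʳ = ⊗₀-unitʳ }
  where open SMC C

module Adjoin (C : SMC) where
  open SMC C
  module O = WordMonoid (Ob⊗ C)
  module A = WordMonoid (Arr C)
  open O using (_◁_; _⊕_)

  data WordHom : Word Ob → Word Ob → Set where
    [_] : ∀ {A B} → Hom A B → WordHom [ A ] [ B ]
    _∷_ : ∀ {A B v w} → Hom A B → WordHom v w → WordHom (A ∷ v) (B ∷ w)

  idW : ∀ {v} → WordHom v v
  idW {[ A ]} = [ id ]
  idW {A ∷ v} = id ∷ idW

  infixr 9 _∘W_
  _∘W_ : ∀ {u v w} → WordHom v w → WordHom u v → WordHom u w
  [ g ] ∘W [ f ] = [ g ∘ f ]
  (g ∷ h) ∘W (f ∷ k) = (g ∘ f) ∷ (h ∘W k)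

  ∘W-identityˡ : ∀ {u v} (f : WordHom u v) → idW ∘W f ≡ f
  ∘W-identityˡ [ f ] = cong [_] (identityˡ f)
  ∘W-identityˡ (f ∷ k) = cong₂ _∷_ (identityˡ f) (∘W-identityˡ k)

  ∘W-identityʳ : ∀ {u v} (f : WordHom u v) → f ∘W idW ≡ f
  ∘W-identityʳ [ f ] = cong [_] (identityʳ f)
  ∘W-identityʳ (f ∷ k) = cong₂ _∷_ (identityʳ f) (∘W-identityʳ k)

  ∘W-assoc : ∀ {a b c d} (h : WordHom c d) (g : WordHom b c) (f : WordHom a b) →
             (h ∘W g) ∘W f ≡ h ∘W (g ∘W f)
  ∘W-assoc [ h ] [ g ] [ f ] = cong [_] (assoc h g f)
  ∘W-assoc (h ∷ h') (g ∷ g') (f ∷ f') = cong₂ _∷_ (assoc h g f) (∘W-assoc h' g' f')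

  _◁W_ : ∀ {A B v w} → Hom A B → WordHom v w → WordHom (A ◁ v) (B ◁ w)
  f ◁W [ g ] = [ f ⊗₁ g ]
  f ◁W (g ∷ h) = (f ⊗₁ g) ∷ h

  _⊗W_ : ∀ {v w v' w'} → WordHom v w → WordHom v' w' → WordHom (v ⊕ v') (w ⊕ w')
  [ f ] ⊗W h = f ◁W h
  (f ∷ h) ⊗W h' = f ∷ (h ⊗W h')

  ◁W-id : ∀ {A} w → id {A} ◁W idW {w} ≡ idW
  ◁W-id [ B ] = cong [_] ⊗-id
  ◁W-id (B ∷ w) = cong (_∷ idW) ⊗-id

  ⊗W-id : ∀ v w → idW {v} ⊗W idW {w} ≡ idW
  ⊗W-id [ A ] w = ◁W-id w
  ⊗W-id (A ∷ v) w = cong (id ∷_) (⊗W-id v w)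

  ◁W-∘ : ∀ {A B B' u v w} (g : Hom B B') (f : Hom A B) (g' : WordHom v w) (f' : WordHom u v) →
         (g ∘ f) ◁W (g' ∘W f') ≡ (g ◁W g') ∘W (f ◁W f')
  ◁W-∘ g f [ g' ] [ f' ] = cong [_] (⊗-∘ g f g' f')
  ◁W-∘ g f (g' ∷ h) (f' ∷ k) = cong (_∷ (h ∘W k)) (⊗-∘ g f g' f')

  ⊗W-∘ : ∀ {a b c a' b' c'} (g : WordHom b c) (f : WordHom a b)
           (g' : WordHom b' c') (f' : WordHom a' b') →
         (g ∘W f) ⊗W (g' ∘W f') ≡ (g ⊗W g') ∘W (f ⊗W f')
  ⊗W-∘ [ g ] [ f ] g' f' = ◁W-∘ g f g' f'
  ⊗W-∘ (g ∷ h) (f ∷ k) g' f' = cong ((g ∘ f) ∷_) (⊗W-∘ h k g' f')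

  WordArrows : Set
  WordArrows = Σ (Word Ob) λ v → Σ (Word Ob) λ w → WordHom v w

  toWord : ∀ {v w} → WordHom v w → Word (Arrows C)
  toWord [ f ] = [ (_ , _ , f) ]
  toWord (f ∷ h) = (_ , _ , f) ∷ toWord h

  fromWord : Word (Arrows C) → WordArrows
  fromWord [ (A , B , f) ] = [ A ] , [ B ] , [ f ]
  fromWord ((A , B , f) ∷ l) with fromWord l
  ... | v , w , h = A ∷ v , B ∷ w , f ∷ h

  fromWord-toWord : ∀ {v w} (h : WordHom v w) → fromWord (toWord h) ≡ (v , w , h)
  fromWord-toWord [ f ] = refl
  fromWord-toWord (f ∷ h) rewrite fromWord-toWord h = refl

  toWord-injective : ∀ {v w v' w'} (h : WordHom v w) (h' : WordHom v' w') →
                     toWord h ≡ toWord h' → _≡_ {A = WordArrows} (v , w , h) (v' , w' , h')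
  toWord-injective h h' eq =
    trans (sym (fromWord-toWord h)) (trans (cong fromWord eq) (fromWord-toWord h'))

  toWord-◁ : ∀ {A B v w} (f : Hom A B) (h : WordHom v w) →
             toWord (f ◁W h) ≡ (A , B , f) A.◁ toWord h
  toWord-◁ f [ g ] = refl
  toWord-◁ f (g ∷ h) = refl

  toWord-⊗ : ∀ {v w v' w'} (h : WordHom v w) (h' : WordHom v' w') →
             toWord (h ⊗W h') ≡ toWord h A.⊕ toWord h'
  toWord-⊗ [ f ] h' = toWord-◁ f h'
  toWord-⊗ (f ∷ h) h' = cong (_ ∷_) (toWord-⊗ h h')

  -- The strictness laws on arrows hold because toWord is injective and turns ⊗W into ⊕.
  C⟨xₒ⟩ : SMC
  C⟨xₒ⟩ = record
    { Ob = Word Ob ; Hom = WordHom ; id = idW ; _∘_ = _∘W_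
    ; identityˡ = ∘W-identityˡ ; identityʳ = ∘W-identityʳ ; assoc = ∘W-assoc
    ; I = [ I ] ; _⊗₀_ = _⊕_ ; _⊗₁_ = _⊗W_
    ; ⊗-id = λ {v} {w} → ⊗W-id v w ; ⊗-∘ = ⊗W-∘
    ; ⊗₀-assoc = O.⊕-assoc ; ⊗₀-unitˡ = O.⊕-identityˡ ; ⊗₀-unitʳ = O.⊕-identityʳ
    ; ⊗₁-assoc = λ f g h → toWord-injective ((f ⊗W g) ⊗W h) (f ⊗W (g ⊗W h)) (begin
        toWord ((f ⊗W g) ⊗W h)                ≡⟨ toWord-⊗ (f ⊗W g) h ⟩
        toWord (f ⊗W g) A.⊕ toWord h          ≡⟨ cong (A._⊕ toWord h) (toWord-⊗ f g) ⟩
        (toWord f A.⊕ toWord g) A.⊕ toWord h  ≡⟨ A.⊕-assoc (toWord f) (toWord g) (toWord h) ⟩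
        toWord f A.⊕ (toWord g A.⊕ toWord h)  ≡⟨ cong (toWord f A.⊕_) (sym (toWord-⊗ g h)) ⟩
        toWord f A.⊕ toWord (g ⊗W h)          ≡⟨ sym (toWord-⊗ f (g ⊗W h)) ⟩
        toWord (f ⊗W (g ⊗W h))                ∎)
    ; ⊗₁-unitˡ = λ f → toWord-injective ([ id ] ⊗W f) f
        (trans (toWord-⊗ [ id ] f) (A.⊕-identityˡ (toWord f)))
    ; ⊗₁-unitʳ = λ f → toWord-injective (f ⊗W [ id ]) f
        (trans (toWord-⊗ f [ id ]) (A.⊕-identityʳ (toWord f)))
    }

  toWordHom : MonHom (Arr C⟨xₒ⟩) (Arr C ⟨x⟩)
  toWordHom = record
    { fun = λ { (_ , _ , h) → toWord h }
    ; pres-∙ = λ { (_ , _ , h) (_ , _ , h') → toWord-⊗ h h' }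
    ; pres-ε = refl }

  ιC : SMF C C⟨xₒ⟩
  ιC = record { F₀ = [_] ; F₁ = [_] ; F-id = refl ; F-∘ = λ _ _ → refl
              ; F-I = refl ; F-⊗₀ = λ _ _ → refl ; F-⊗₁ = λ _ _ → refl }

  xPow : ℕ → Word Ob
  xPow zero = [ I ]
  xPow (suc n) = I ∷ xPow n

  xPow-+ : ∀ n m → xPow (n + m) ≡ xPow n ⊕ xPow m
  xPow-+ zero m = sym (O.⊕-identityˡ (xPow m))
  xPow-+ (suc n) m = cong (I ∷_) (xPow-+ n m)

  xPow₁ : ∀ {n m} → n ≡ m → WordHom (xPow n) (xPow m)
  xPow₁ refl = idW

  ιX : SMF FreeSMC1 C⟨xₒ⟩
  ιX = record
    { F₀ = xPow ; F₁ = xPow₁ ; F-id = refl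
    ; F-∘ = λ { refl refl → sym (∘W-identityˡ idW) }
    ; F-I = refl ; F-⊗₀ = xPow-+
    ; F-⊗₁ = λ { {n} {_} {m} refl refl →
        trans (idArrow-cong C⟨xₒ⟩ (xPow-+ n m))
              (cong (λ g → _ , _ , g) (sym (⊗W-id (xPow n) (xPow m)))) } }

  eval-xPow : ∀ {Q} (φ : MonHom (Arr C) Q) (g : MonHom FreeMon1 Q) →
              ∀ n → eval φ (fun g 1) (toWord (idW {xPow n})) ≡ fun g n
  eval-xPow {Q} φ g zero = trans (pres-ε φ) (sym (pres-ε g))
  eval-xPow {Q} φ g (suc n) = begin
    fun φ (I , I , id) ∙ (fun g 1 ∙ eval φ (fun g 1) (toWord (idW {xPow n})))
      ≡⟨ cong₂ _∙_ (pres-ε φ) (cong (fun g 1 ∙_) (eval-xPow φ g n)) ⟩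
    ε ∙ (fun g 1 ∙ fun g n) ≡⟨ Mon.identityˡ Q _ ⟩
    fun g 1 ∙ fun g n       ≡⟨ sym (pres-∙ g 1 n) ⟩
    fun g (suc n)           ∎
    where open Mon Q

  module Copair {E : SMC} (F : SMF C E) (Fx : SMF FreeSMC1 E) where
    private
      module E = SMC E
      module F = SMF F
      module Fx = SMF Fx
      module ArrE = Mon (Arr E)

    xₒ : E.Ob
    xₒ = Fx.F₀ 1

    xArr : Arrows E
    xArr = arrMap Fx (1 , 1 , refl)

    copair₀ : Word Ob → E.Ob
    copair₀ [ A ] = F.F₀ A
    copair₀ (A ∷ v) = F.F₀ A E.⊗₀ (xₒ E.⊗₀ copair₀ v)

    copair₁ : ∀ {v w} → WordHom v w → E.Hom (copair₀ v) (copair₀ w)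
    copair₁ [ f ] = F.F₁ f
    copair₁ (f ∷ h) = F.F₁ f E.⊗₁ (Fx.F₁ {1} refl E.⊗₁ copair₁ h)

    copair-id : ∀ {v} → copair₁ (idW {v}) ≡ E.id
    copair-id {[ A ]} = F.F-id
    copair-id {A ∷ v} = begin
      F.F₁ id E.⊗₁ (Fx.F₁ {1} refl E.⊗₁ copair₁ (idW {v}))
        ≡⟨ cong₂ E._⊗₁_ F.F-id (cong₂ E._⊗₁_ Fx.F-id (copair-id {v})) ⟩
      E.id E.⊗₁ (E.id E.⊗₁ E.id) ≡⟨ cong (E.id E.⊗₁_) E.⊗-id ⟩
      E.id E.⊗₁ E.id             ≡⟨ E.⊗-id ⟩
      E.id                       ∎

    copair-∘ : ∀ {u v w} (g : WordHom v w) (f : WordHom u v) →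
               copair₁ (g ∘W f) ≡ copair₁ g E.∘ copair₁ f
    copair-∘ [ g ] [ f ] = F.F-∘ g f
    copair-∘ (g ∷ h) (f ∷ k) = begin
      F.F₁ (g ∘ f) E.⊗₁ (x₁ E.⊗₁ copair₁ (h ∘W k))
        ≡⟨ cong₂ E._⊗₁_ (F.F-∘ g f) (cong₂ E._⊗₁_ (Fx.F-∘ {1} refl refl) (copair-∘ h k)) ⟩
      (F.F₁ g E.∘ F.F₁ f) E.⊗₁ ((x₁ E.∘ x₁) E.⊗₁ (copair₁ h E.∘ copair₁ k))
        ≡⟨ cong ((F.F₁ g E.∘ F.F₁ f) E.⊗₁_) (E.⊗-∘ _ _ _ _) ⟩
      (F.F₁ g E.∘ F.F₁ f) E.⊗₁ ((x₁ E.⊗₁ copair₁ h) E.∘ (x₁ E.⊗₁ copair₁ k))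
        ≡⟨ E.⊗-∘ _ _ _ _ ⟩
      copair₁ (g ∷ h) E.∘ copair₁ (f ∷ k) ∎
      where x₁ = Fx.F₁ {1} refl

    copair-◁ : ∀ A w → copair₀ (A ◁ w) ≡ F.F₀ A E.⊗₀ copair₀ w
    copair-◁ A [ B ] = F.F-⊗₀ A B
    copair-◁ A (B ∷ w) =
      trans (cong (E._⊗₀ (xₒ E.⊗₀ copair₀ w)) (F.F-⊗₀ A B)) (E.⊗₀-assoc _ _ _)

    copair-⊗₀ : ∀ v w → copair₀ (v ⊕ w) ≡ copair₀ v E.⊗₀ copair₀ w
    copair-⊗₀ [ A ] w = copair-◁ A w
    copair-⊗₀ (A ∷ v) w = begin
      F.F₀ A E.⊗₀ (xₒ E.⊗₀ copair₀ (v ⊕ w))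
        ≡⟨ cong (λ t → F.F₀ A E.⊗₀ (xₒ E.⊗₀ t)) (copair-⊗₀ v w) ⟩
      F.F₀ A E.⊗₀ (xₒ E.⊗₀ (copair₀ v E.⊗₀ copair₀ w))
        ≡⟨ cong (F.F₀ A E.⊗₀_) (sym (E.⊗₀-assoc _ _ _)) ⟩
      F.F₀ A E.⊗₀ ((xₒ E.⊗₀ copair₀ v) E.⊗₀ copair₀ w)
        ≡⟨ sym (E.⊗₀-assoc _ _ _) ⟩
      (F.F₀ A E.⊗₀ (xₒ E.⊗₀ copair₀ v)) E.⊗₀ copair₀ w ∎

    arr-copair : ∀ {v w} (h : WordHom v w) →
                 _≡_ {A = Arrows E} (copair₀ v , copair₀ w , copair₁ h)
                                    (eval (arrHom F) xArr (toWord h))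
    arr-copair [ f ] = refl
    arr-copair (f ∷ h) = cong (λ t → arrMap F (_ , _ , f) ArrE.∙ (xArr ArrE.∙ t)) (arr-copair h)

    copair : SMF C⟨xₒ⟩ E
    copair = record
      { F₀ = copair₀ ; F₁ = copair₁ ; F-id = λ {v} → copair-id {v} ; F-∘ = copair-∘
      ; F-I = F.F-I ; F-⊗₀ = copair-⊗₀
      ; F-⊗₁ = λ f g → begin
          _ ≡⟨ arr-copair (f ⊗W g) ⟩
          eval (arrHom F) xArr (toWord (f ⊗W g))
            ≡⟨ pres-∙ (evalHom (arrHom F) xArr ∘M toWordHom) (_ , _ , f) (_ , _ , g) ⟩
          eval (arrHom F) xArr (toWord f) ArrE.∙ eval (arrHom F) xArr (toWord g)
            ≡⟨ sym (cong₂ ArrE._∙_ (arr-copair f) (arr-copair g)) ⟩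
          _ ∎ }

    copair∘ιC : (copair ∘F ιC) ≈F F
    copair∘ιC = (λ _ → refl) , λ _ → refl

    copair-xPow : ∀ n → copair₀ (xPow n) ≡ Fx.F₀ n
    copair-xPow zero = trans F.F-I (sym Fx.F-I)
    copair-xPow (suc n) = begin
      F.F₀ I E.⊗₀ (xₒ E.⊗₀ copair₀ (xPow n))
        ≡⟨ cong₂ (λ s t → s E.⊗₀ (xₒ E.⊗₀ t)) F.F-I (copair-xPow n) ⟩
      E.I E.⊗₀ (xₒ E.⊗₀ Fx.F₀ n) ≡⟨ E.⊗₀-unitˡ _ ⟩
      xₒ E.⊗₀ Fx.F₀ n            ≡⟨ sym (Fx.F-⊗₀ 1 n) ⟩
      Fx.F₀ (suc n)              ∎

    copair∘ιX : (copair ∘F ιX) ≈F Fx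
    copair∘ιX = copair-xPow , λ { {n} refl → begin
      (copair₀ (xPow n) , _ , copair₁ (idW {xPow n}))
        ≡⟨ cong (λ g → _ , _ , g) (copair-id {xPow n}) ⟩
      (copair₀ (xPow n) , _ , E.id) ≡⟨ idArrow-cong E (copair-xPow n) ⟩
      (Fx.F₀ n , _ , E.id)          ≡⟨ cong (λ g → _ , _ , g) (sym Fx.F-id) ⟩
      arrMap Fx (n , n , refl)      ∎ }

-- Given f and g, the mediating map sends an arrow t of E to the evaluation, with x ↦ g 1,
-- of the word of C-arrows that t becomes in C⟨xₒ⟩; any other mediating map agrees with it
-- because t = copair (H t) and copair lands in evaluated words.
arr-coproduct : ∀ {C E} (ι : SMF C E) (ιx : SMF FreeSMC1 E) →
                IsCoproductSMC ι ιx → IsCoproductMon (arrHom ι) (arrHom ιx ∘M identities)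
arr-coproduct {C} {E} ι ιx copE Q f g = h , h∘ι≈f , h∘x≈g , unique
  where
  open Adjoin C
  open Copair ι ιx

  H : SMF E C⟨xₒ⟩
  H = proj₁ (copE C⟨xₒ⟩ ιC ιX)

  H∘ι≈ιC : (H ∘F ι) ≈F ιC
  H∘ι≈ιC = proj₁ (proj₂ (copE C⟨xₒ⟩ ιC ιX))

  H∘ιx≈ιX : (H ∘F ιx) ≈F ιX
  H∘ιx≈ιX = proj₁ (proj₂ (proj₂ (copE C⟨xₒ⟩ ιC ιX)))

  copair∘H≈id : ∀ t → arrMap copair (arrMap H t) ≡ t
  copair∘H≈id = coproductSMC-endo≈id {i = ι} {ιx} copE (copair ∘F H)
    (∘F-resp-≈F copair (H ∘F ι) ιC ι H∘ι≈ιC copair∘ιC)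
    (∘F-resp-≈F copair (H ∘F ιx) ιX ιx H∘ιx≈ιX copair∘ιX)

  evalWord : MonHom (Arr C⟨xₒ⟩) Q
  evalWord = evalHom f (fun g 1) ∘M toWordHom

  h : MonHom (Arr E) Q
  h = evalWord ∘M arrHom H

  h∘ι≈f : (h ∘M arrHom ι) ≈M f
  h∘ι≈f (_ , _ , a) = cong (fun evalWord) (proj₂ H∘ι≈ιC a)

  h∘x≈g : (h ∘M (arrHom ιx ∘M identities)) ≈M g
  h∘x≈g n = trans (cong (fun evalWord) (proj₂ H∘ιx≈ιX {n} refl)) (eval-xPow f g n)

  unique : (h' : MonHom (Arr E) Q) → (h' ∘M arrHom ι) ≈M f →
           (h' ∘M (arrHom ιx ∘M identities)) ≈M g → h' ≈M h
  unique h' h'∘ι≈f h'∘x≈g (A , B , a) = begin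
    fun h' (A , B , a)                            ≡⟨ cong (fun h') (sym (copair∘H≈id _)) ⟩
    fun h' (arrMap copair (arrMap H (A , B , a))) ≡⟨ cong (fun h') (arr-copair (F₁ H a)) ⟩
    fun h' (eval (arrHom ι) xArr (toWord (F₁ H a)))
      ≡⟨ eval-unique (arrHom ι) xArr h' h'∘ι≈f (h'∘x≈g 1) (toWord (F₁ H a)) ⟩
    fun h (A , B , a)                             ∎

lemma11 : (C E : SMC) (ι : SMF C E) (ιx : SMF FreeSMC1 E) →
    IsCoproductSMC ι ιx →
    (P : Mon) (κ : MonHom (Arr C) P) (κx : MonHom FreeMon1 P) →
    IsCoproductMon κ κx →
    MonIso (Arr E) P
lemma11 C E ι ιx copE P κ κx copP =
  coproductMon-unique {i = arrHom ι} {arrHom ιx ∘M identities} {κ} {κx}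
    (arr-coproduct ι ιx copE) copP
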